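{- Let $G$ be a complete multi-partite graph and let $V_1,V_2$ be disjoint subsets of $V(G)$ with $V_2\ne\emptyset$. If $\chi(G[V_2])=r$ and $\chi(G[V_1\cup V_2])=k$, then there exists $u\in V_2$ such that $$|N_G(u)\cap V_1|\ge\frac{(r-1)|V_1|+k-r}{r}\ge\frac{(r-1)|V_1|}{r}.$$
   Context: $N_G(u)$ denotes the set of neighbors of $u$ in $G$; $G[U]$ is the subgraph induced by $U$; $\chi$ is the chromatic number. -}

module Defs where

open import Data.Nat using (ℕ)
open import Data.Fin using (Fin)
open import Data.Fin.Subset using (Subset; _∈_; _∪_)
open import Data.Vec using (tabulate)
open import Data.Product using (Σ; ∃; _×_)
open import Relation.Nullary using (¬_)
open import Relation.Nullary.Decidable using (⌊_⌋)
open import Relation.Binary using (Decidable)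
open import Relation.Binary.PropositionalEquality using (_≡_; _≢_)
open import Function.Bundles using (_⇔_)
open import Data.Nat using (_≤_)

record Graph (n : ℕ) : Set₁ where
  field
    Adj    : Fin n → Fin n → Set
    adj?   : Decidable Adj
    sym    : ∀ {u v} → Adj u v → Adj v u
    irrefl : ∀ {u} → ¬ Adj u u
open Graph public

IsCompleteMultipartite : ∀ {n} → Graph n → Set
IsCompleteMultipartite {n} G =
  Σ (Fin n → ℕ) λ part → ∀ u v → Adj G u v ⇔ (part u ≢ part v)

N : ∀ {n} → Graph n → Fin n → Subset n
N G u = tabulate λ v → ⌊ adj? G u v ⌋

Colorable : ∀ {n} → Graph n → Subset n → ℕ → Set
Colorable {n} G U j =
  Σ (Fin n → Fin j) λ c → ∀ u v → u ∈ U → v ∈ U → Adj G u v → c u ≢ c v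

ChromaticNumber : ∀ {n} → Graph n → Subset n → ℕ → Set
ChromaticNumber G U k = Colorable G U k × (∀ j → Colorable G U j → k ≤ j)

-- In a complete multipartite graph, colouring each vertex of V₂ by its part shows that r is at
-- most the number s of parts meeting V₂; and an optimal colouring of G[V₂] extends to
-- G[V₁ ∪ V₂] by giving every vertex of V₁ in a part meeting V₂ the colour of a vertex of V₂ in
-- that part and a fresh colour to each remaining vertex, so k ≤ r + w with w the number of those remaining vertices.
-- The s parts meeting V₂ together contain |V₁| − w vertices of V₁, so one of them, containing
-- u ∈ V₂, contains at most (|V₁| − w)/s ≤ (|V₁| − (k − r))/r of them; all other vertices of V₁
-- are neighbours of u.
module Submission where

open import Defs
open import Data.Nat using (ℕ; _≤_; _*_; _+_; _∸_)
open import Data.Fin using (Fin)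
open import Data.Fin.Subset using (Subset; _∈_; _∩_; _∪_; ∣_∣; Nonempty)
open import Data.Product using (∃; _×_)
open import Data.Empty using (⊥)

open import Data.Nat using (zero; suc)
open import Data.Nat.Properties
  using (+-suc; +-assoc; +-comm; ≤-refl; ≤-reflexive; ≤-trans; +-mono-≤; +-monoˡ-≤; +-monoʳ-≤;
         *-monoˡ-≤; *-monoʳ-≤; *-distribˡ-+; +-cancelʳ-≤; m≤m+n; m≤n+o⇒m∸n≤o; module ≤-Reasoning)
  renaming (_≟_ to _≟ℕ_)
open import Data.Nat.ListAction using (sum)
open import Data.Fin using (zero; suc; join; splitAt)
open import Data.Fin.Properties using (suc-injective; ¬Fin0; splitAt-join)
open import Data.Fin.Subset using (inside; outside; _─_; ⋃; _∉_; _⊆_)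
open import Data.Fin.Subset.Properties
  using (_∈?_; ∉⊥; x∈p∪q⁺; x∈p∪q⁻; x∈p∩q⁺; x∈p∩q⁻; x∈p∧x∉q⇒x∈p─q; p─q⊆p; p─⊥≡p;
         p─q─r≡p─q∪r; p⊆q⇒∣p∣≤∣q∣)
open import Data.Vec using ([]; _∷_; tabulate; here; there)
open import Data.Vec.Properties using (lookup∘tabulate; []=⇒lookup; lookup⇒[]=)
open import Data.List using (List; []; _∷_; length; map; filter; allFin; deduplicate)
open import Data.List.Properties using (length-map)
open import Data.List.Relation.Unary.All as All using (All; []; _∷_)
open import Data.List.Relation.Unary.All.Properties as Allₚ using ()
open import Data.List.Relation.Unary.Any as Any using (here; there)
open import Data.List.Relation.Unary.AllPairs using ([]; _∷_)
open import Data.List.Relation.Unary.Unique.Propositional using (Unique)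
open import Data.List.Relation.Unary.Unique.DecPropositional.Properties _≟ℕ_ using (deduplicate-!)
open import Data.List.Membership.Propositional using () renaming (_∈_ to _∈ˡ_; _∉_ to _∉ˡ_)
open import Data.List.Membership.Propositional.Properties
  using (∈-map⁺; ∈-map⁻; ∈-filter⁺; ∈-filter⁻; ∈-allFin; ∈-deduplicate⁺; ∈-deduplicate⁻)
open import Data.List.Membership.DecPropositional _≟ℕ_ using () renaming (_∈?_ to _∈ˡ?_)
import Data.List.Membership.Setoid.Properties as Membershipₛ
open import Data.List.Extrema.Nat using (argmin; argmin-sel; f[argmin]≤f[xs])
open import Data.Bool.Properties using (T-≡)
open import Data.Product using (_,_; proj₁; proj₂)
open import Data.Sum using (_⊎_; inj₁; inj₂)
open import Data.Sum.Properties using (inj₁-injective; inj₂-injective)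
open import Function using (_∘_)
open import Function.Bundles using (Equivalence; _⇔_)
open import Relation.Unary using (Pred; Decidable)
open import Relation.Nullary using (¬_; yes; no; contradiction)
open import Relation.Nullary.Decidable using (⌊_⌋; toWitness; fromWitness; decidable-stable)
open import Relation.Binary.PropositionalEquality
  using (_≡_; _≢_; refl; trans; cong; subst; setoid) renaming (sym to ≡-sym)

module _ {n a} {P : Pred (Fin n) a} (P? : Decidable P) where

  ∈-tabulate⁺ : ∀ {x} → P x → x ∈ tabulate (λ v → ⌊ P? v ⌋)
  ∈-tabulate⁺ {x} px =
    lookup⇒[]= x _ (trans (lookup∘tabulate _ x) (Equivalence.to T-≡ (fromWitness px)))

  ∈-tabulate⁻ : ∀ {x} → x ∈ tabulate (λ v → ⌊ P? v ⌋) → P x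
  ∈-tabulate⁻ {x} x∈ =
    toWitness (Equivalence.from T-≡ (trans (≡-sym (lookup∘tabulate _ x)) ([]=⇒lookup x∈)))

x∈p─q⇒x∉q : ∀ {n} {p q : Subset n} {x} → x ∈ p ─ q → x ∉ q
x∈p─q⇒x∉q {p = inside ∷ p} {outside ∷ q} here        ()
x∈p─q⇒x∉q {p = _      ∷ p} {_       ∷ q} (there x∈) (there x∈q) = x∈p─q⇒x∉q x∈ x∈q

∣p∩q∣+∣p─q∣≡∣p∣ : ∀ {n} (p q : Subset n) → ∣ p ∩ q ∣ + ∣ p ─ q ∣ ≡ ∣ p ∣
∣p∩q∣+∣p─q∣≡∣p∣ []            []            = refl
∣p∩q∣+∣p─q∣≡∣p∣ (inside  ∷ p) (inside  ∷ q) = cong suc (∣p∩q∣+∣p─q∣≡∣p∣ p q)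
∣p∩q∣+∣p─q∣≡∣p∣ (inside  ∷ p) (outside ∷ q) =
  trans (+-suc ∣ p ∩ q ∣ _) (cong suc (∣p∩q∣+∣p─q∣≡∣p∣ p q))
∣p∩q∣+∣p─q∣≡∣p∣ (outside ∷ p) (inside  ∷ q) = ∣p∩q∣+∣p─q∣≡∣p∣ p q
∣p∩q∣+∣p─q∣≡∣p∣ (outside ∷ p) (outside ∷ q) = ∣p∩q∣+∣p─q∣≡∣p∣ p q

rank : ∀ {n} {p : Subset n} {x} → x ∈ p → Fin ∣ p ∣
rank {p = inside  ∷ p} here        = zero
rank {p = inside  ∷ p} (there x∈p) = suc (rank x∈p)
rank {p = outside ∷ p} (there x∈p) = rank x∈p

rank-injective : ∀ {n} {p : Subset n} {x y} (x∈p : x ∈ p) (y∈p : y ∈ p) →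
                 rank x∈p ≡ rank y∈p → x ≡ y
rank-injective {p = inside  ∷ p} here        here        _ = refl
rank-injective {p = inside  ∷ p} (there x∈p) (there y∈p) e =
  cong suc (rank-injective x∈p y∈p (suc-injective e))
rank-injective {p = outside ∷ p} (there x∈p) (there y∈p) e =
  cong suc (rank-injective x∈p y∈p e)

join-injective : ∀ m n {i j : Fin m ⊎ Fin n} → join m n i ≡ join m n j → i ≡ j
join-injective m n {i} {j} e =
  trans (≡-sym (splitAt-join m n i)) (trans (cong (splitAt m) e) (splitAt-join m n j))

sum-map-mono : ∀ {a} {A : Set a} {f g : A → ℕ} {xs : List A} →
               All (λ x → f x ≤ g x) xs → sum (map f xs) ≤ sum (map g xs)
sum-map-mono []          = ≤-refl
sum-map-mono (fx≤gx ∷ h) = +-mono-≤ fx≤gx (sum-map-mono h)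

length*≤sum : ∀ {m} {ns : List ℕ} → All (m ≤_) ns → length ns * m ≤ sum ns
length*≤sum []           = ≤-refl
length*≤sum (m≤n ∷ m≤ns) = +-mono-≤ m≤n (length*≤sum m≤ns)

min≤average : ∀ {a} {A : Set a} (f : A → ℕ) {x : A} {xs : List A} → x ∈ˡ xs →
              ∃ λ y → y ∈ˡ xs × length xs * f y ≤ sum (map f xs)
min≤average {A = A} f {x} {xs} x∈xs = y , y∈xs ,
  subst (_≤ sum (map f xs)) (cong (_* f y) (length-map f xs))
        (length*≤sum (Allₚ.map⁺ (f[argmin]≤f[xs] x xs)))
  where
  y : A
  y = argmin f x xs
  y∈xs : y ∈ˡ xs
  y∈xs with argmin-sel f x xs
  ... | inj₁ y≡x  = subst (_∈ˡ xs) (≡-sym y≡x) x∈xs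
  ... | inj₂ y∈xs = y∈xs

partialColoring⇒Colorable : ∀ {n} (G : Graph n) {U : Subset n} {j} → Nonempty U →
  (col : ∀ {v} → v ∈ U → Fin j) →
  (∀ {u v} (u∈U : u ∈ U) (v∈U : v ∈ U) → Adj G u v → col u∈U ≢ col v∈U) →
  Colorable G U j
partialColoring⇒Colorable {n} G {U} {j} (v₀ , v₀∈U) col col-proper = c , c-proper
  where
  c : Fin n → Fin j
  c v with v ∈? U
  ... | yes v∈U = col v∈U
  ... | no  _   = col v₀∈U
  c-proper : ∀ u v → u ∈ U → v ∈ U → Adj G u v → c u ≢ c v
  c-proper u v u∈U v∈U adj with u ∈? U | v ∈? U
  ... | yes u∈U′ | yes v∈U′ = col-proper u∈U′ v∈U′ adj
  ... | no  u∉U  | _        = contradiction u∈U u∉U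
  ... | yes _    | no  v∉U  = contradiction v∈U v∉U

r*V+w≤[1+r]*N : ∀ r {V N a w} → suc r * a + w ≤ V → V ≤ N + a → r * V + w ≤ suc r * N
r*V+w≤[1+r]*N r {V} {N} {a} {w} ra+w≤V V≤N+a = +-cancelʳ-≤ (suc r * a) _ _ (begin
    (r * V + w) + suc r * a
  ≡⟨ +-assoc (r * V) w _ ⟩
    r * V + (w + suc r * a)
  ≡⟨ cong (r * V +_) (+-comm w _) ⟩
    r * V + (suc r * a + w)
  ≤⟨ +-monoʳ-≤ (r * V) ra+w≤V ⟩
    r * V + V
  ≡⟨ +-comm (r * V) V ⟩
    suc r * V
  ≤⟨ *-monoʳ-≤ (suc r) V≤N+a ⟩
    suc r * (N + a)
  ≡⟨ *-distribˡ-+ (suc r) N a ⟩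
    suc r * N + suc r * a
  ∎)
  where open ≤-Reasoning

module Parts {n} (part : Fin n → ℕ) where

  fibre : ℕ → Subset n
  fibre l = tabulate (λ v → ⌊ part v ≟ℕ l ⌋)

  fibres : List ℕ → Subset n
  fibres ls = ⋃ (map fibre ls)

  labelsOf : Subset n → List ℕ
  labelsOf X = deduplicate _≟ℕ_ (map part (filter (_∈? X) (allFin n)))

  labelsOf-unique : ∀ X → Unique (labelsOf X)
  labelsOf-unique X = deduplicate-! _

  part∈labelsOf : ∀ {X v} → v ∈ X → part v ∈ˡ labelsOf X
  part∈labelsOf {X} {v} v∈X =
    ∈-deduplicate⁺ _≟ℕ_ (∈-map⁺ part (∈-filter⁺ (_∈? X) (∈-allFin v) v∈X))

  ∈-labelsOf⁻ : ∀ {X l} → l ∈ˡ labelsOf X → ∃ λ v → v ∈ X × part v ≡ l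
  ∈-labelsOf⁻ {X} l∈ with ∈-map⁻ part (∈-deduplicate⁻ _≟ℕ_ _ l∈)
  ... | v , v∈ , refl = v , proj₂ (∈-filter⁻ (_∈? X) {xs = allFin n} v∈) , refl

  ∈-fibres⁻ : ∀ {ls x} → x ∈ fibres ls → part x ∈ˡ ls
  ∈-fibres⁻ {[]}     x∈⊥ = contradiction x∈⊥ ∉⊥
  ∈-fibres⁻ {l ∷ ls} x∈  with x∈p∪q⁻ (fibre l) (fibres ls) x∈
  ... | inj₁ x∈fl   = here (∈-tabulate⁻ (λ v → part v ≟ℕ l) x∈fl)
  ... | inj₂ x∈rest = there (∈-fibres⁻ x∈rest)

  ∩fibre⊆─fibre : ∀ X {l l′} → l ≢ l′ → X ∩ fibre l′ ⊆ (X ─ fibre l) ∩ fibre l′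
  ∩fibre⊆─fibre X {l} {l′} l≢l′ {x} x∈ with x∈p∩q⁻ X (fibre l′) x∈
  ... | x∈X , x∈fl′ = x∈p∩q⁺ (x∈p∧x∉q⇒x∈p─q x∈X x∉fl , x∈fl′)
    where
    x∉fl : x ∉ fibre l
    x∉fl x∈fl = l≢l′ (trans (≡-sym (∈-tabulate⁻ (λ v → part v ≟ℕ l) x∈fl))
                             (∈-tabulate⁻ (λ v → part v ≟ℕ l′) x∈fl′))

  sum∣∩fibre∣+∣─fibres∣≤∣∣ : ∀ X {ls} → Unique ls →
    sum (map (λ l → ∣ X ∩ fibre l ∣) ls) + ∣ X ─ fibres ls ∣ ≤ ∣ X ∣
  sum∣∩fibre∣+∣─fibres∣≤∣∣ X {[]}     []              = ≤-reflexive (cong ∣_∣ (p─⊥≡p X))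
  sum∣∩fibre∣+∣─fibres∣≤∣∣ X {l ∷ ls} (l≢ls ∷ unique) = begin
      (∣ X ∩ fibre l ∣ + sum (map (λ l′ → ∣ X ∩ fibre l′ ∣) ls)) + ∣ X ─ fibres (l ∷ ls) ∣
    ≡⟨ +-assoc ∣ X ∩ fibre l ∣ _ _ ⟩
      ∣ X ∩ fibre l ∣ + (sum (map (λ l′ → ∣ X ∩ fibre l′ ∣) ls) + ∣ X ─ fibres (l ∷ ls) ∣)
    ≡⟨ cong (λ Y → ∣ X ∩ fibre l ∣ + (_ + ∣ Y ∣))
            (≡-sym (p─q─r≡p─q∪r X (fibre l) (fibres ls))) ⟩
      ∣ X ∩ fibre l ∣ + (sum (map (λ l′ → ∣ X ∩ fibre l′ ∣) ls) + ∣ X ─ fibre l ─ fibres ls ∣)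
    ≤⟨ +-monoʳ-≤ ∣ X ∩ fibre l ∣ (+-monoˡ-≤ _
         (sum-map-mono (All.map (p⊆q⇒∣p∣≤∣q∣ ∘ ∩fibre⊆─fibre X) l≢ls))) ⟩
      ∣ X ∩ fibre l ∣ + (sum (map (λ l′ → ∣ (X ─ fibre l) ∩ fibre l′ ∣) ls)
                          + ∣ X ─ fibre l ─ fibres ls ∣)
    ≤⟨ +-monoʳ-≤ ∣ X ∩ fibre l ∣ (sum∣∩fibre∣+∣─fibres∣≤∣∣ (X ─ fibre l) unique) ⟩
      ∣ X ∩ fibre l ∣ + ∣ X ─ fibre l ∣
    ≡⟨ ∣p∩q∣+∣p─q∣≡∣p∣ X (fibre l) ⟩
      ∣ X ∣
    ∎
    where open ≤-Reasoning

module CompleteMultipartite {n} (G : Graph n) (part : Fin n → ℕ)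
                            (adj⇔ : ∀ u v → Adj G u v ⇔ (part u ≢ part v)) where
  open Parts part

  nonadjacent⇒samePart : ∀ {u v} → ¬ Adj G u v → part u ≡ part v
  nonadjacent⇒samePart {u} {v} ¬adj =
    decidable-stable (part u ≟ℕ part v) (¬adj ∘ Equivalence.from (adj⇔ u v))

  ∣X∣≤∣N∩X∣+∣X∩fibre∣ : ∀ X u → ∣ X ∣ ≤ ∣ N G u ∩ X ∣ + ∣ X ∩ fibre (part u) ∣
  ∣X∣≤∣N∩X∣+∣X∩fibre∣ X u = begin
      ∣ X ∣
    ≡⟨ ≡-sym (∣p∩q∣+∣p─q∣≡∣p∣ X (fibre (part u))) ⟩
      ∣ X ∩ fibre (part u) ∣ + ∣ X ─ fibre (part u) ∣
    ≤⟨ +-monoʳ-≤ _ (p⊆q⇒∣p∣≤∣q∣ X─fibre⊆N∩X) ⟩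
      ∣ X ∩ fibre (part u) ∣ + ∣ N G u ∩ X ∣
    ≡⟨ +-comm ∣ X ∩ fibre (part u) ∣ _ ⟩
      ∣ N G u ∩ X ∣ + ∣ X ∩ fibre (part u) ∣
    ∎
    where
    open ≤-Reasoning
    X─fibre⊆N∩X : X ─ fibre (part u) ⊆ N G u ∩ X
    X─fibre⊆N∩X {x} x∈ =
      x∈p∩q⁺ (∈-tabulate⁺ (adj? G u) (Equivalence.from (adj⇔ u x) part-u≢part-x) , p─q⊆p X _ x∈)
      where
      part-u≢part-x : part u ≢ part x
      part-u≢part-x e = x∈p─q⇒x∉q x∈ (∈-tabulate⁺ (λ v → part v ≟ℕ part u) (≡-sym e))

  colorable-labelsOf : ∀ {U} → Nonempty U → Colorable G U (length (labelsOf U))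
  colorable-labelsOf U≢∅ =
    partialColoring⇒Colorable G U≢∅ (Any.index ∘ part∈labelsOf) λ {u} {v} u∈U v∈U adj e →
      Equivalence.to (adj⇔ u v) adj
        (Membershipₛ.index-injective (setoid ℕ) (part∈labelsOf u∈U) (part∈labelsOf v∈U) e)

  module _ {V₁ V₂ : Subset n} {r} (χ₂ : Colorable G V₂ r) where

    private
      c : Fin n → Fin r
      c = proj₁ χ₂

      W : Subset n
      W = V₁ ─ fibres (labelsOf V₂)

      representative : ∀ {l} → l ∈ˡ labelsOf V₂ → Fin n
      representative = proj₁ ∘ ∈-labelsOf⁻

      representative-injective : ∀ {l l′} (l∈ : l ∈ˡ labelsOf V₂) (l′∈ : l′ ∈ˡ labelsOf V₂) →
                                 c (representative l∈) ≡ c (representative l′∈) → l ≡ l′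
      representative-injective l∈ l′∈ e with ∈-labelsOf⁻ l∈ | ∈-labelsOf⁻ l′∈
      ... | w , w∈V₂ , refl | w′ , w′∈V₂ , refl =
        nonadjacent⇒samePart λ adj → proj₂ χ₂ w w′ w∈V₂ w′∈V₂ adj e

      ∈W : ∀ {v} → v ∈ V₁ ∪ V₂ → part v ∉ˡ labelsOf V₂ → v ∈ W
      ∈W {v} v∈ l∉ with x∈p∪q⁻ V₁ V₂ v∈
      ... | inj₁ v∈V₁ = x∈p∧x∉q⇒x∈p─q v∈V₁ (l∉ ∘ ∈-fibres⁻)
      ... | inj₂ v∈V₂ = contradiction (part∈labelsOf v∈V₂) l∉

      colour : ∀ {v} → v ∈ V₁ ∪ V₂ → Fin r ⊎ Fin ∣ W ∣
      colour {v} v∈ with part v ∈ˡ? labelsOf V₂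
      ... | yes l∈ = inj₁ (c (representative l∈))
      ... | no  l∉ = inj₂ (rank (∈W v∈ l∉))

      colour-proper : ∀ {u v} (u∈ : u ∈ V₁ ∪ V₂) (v∈ : v ∈ V₁ ∪ V₂) → Adj G u v →
                      colour u∈ ≢ colour v∈
      colour-proper {u} {v} u∈ v∈ adj with part u ∈ˡ? labelsOf V₂ | part v ∈ˡ? labelsOf V₂
      ... | yes lu | yes lv = λ e →
              Equivalence.to (adj⇔ u v) adj (representative-injective lu lv (inj₁-injective e))
      ... | yes _  | no  _  = λ ()
      ... | no  _  | yes _  = λ ()
      ... | no  lu | no  lv = λ e →
              irrefl G (subst (Adj G u)
                              (≡-sym (rank-injective (∈W u∈ lu) (∈W v∈ lv) (inj₂-injective e))) adj)

    extend-coloring : Nonempty V₂ → Colorable G (V₁ ∪ V₂) (r + ∣ V₁ ─ fibres (labelsOf V₂) ∣)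
    extend-coloring (v , v∈V₂) =
      partialColoring⇒Colorable G (v , x∈p∪q⁺ (inj₂ v∈V₂)) (join r _ ∘ colour)
        λ u∈ v∈ adj e → colour-proper u∈ v∈ adj (join-injective r _ e)

  ∃-vertex-adjacent-to-most-of : ∀ {V₁ V₂ r k} → Nonempty V₂ →
    ChromaticNumber G V₂ (suc r) → ChromaticNumber G (V₁ ∪ V₂) k →
    ∃ λ u → u ∈ V₂ × r * ∣ V₁ ∣ + (k ∸ suc r) ≤ suc r * ∣ N G u ∩ V₁ ∣
  ∃-vertex-adjacent-to-most-of {V₁} {V₂} {r} {k} V₂≢∅@(v₀ , v₀∈V₂) (colr , r-min) (_ , k-min)
    with min≤average (λ l → ∣ V₁ ∩ fibre l ∣) (part∈labelsOf v₀∈V₂)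
  ... | l , l∈ , s*a≤Σa with ∈-labelsOf⁻ l∈
  ... | u , u∈V₂ , refl = u , u∈V₂ , (begin
      r * ∣ V₁ ∣ + (k ∸ suc r)
    ≤⟨ +-monoʳ-≤ (r * ∣ V₁ ∣) (m≤n+o⇒m∸n≤o k (suc r) k≤r+w) ⟩
      r * ∣ V₁ ∣ + ∣ W ∣
    ≤⟨ r*V+w≤[1+r]*N r ra+w≤V (∣X∣≤∣N∩X∣+∣X∩fibre∣ V₁ u) ⟩
      suc r * ∣ N G u ∩ V₁ ∣
    ∎)
    where
    open ≤-Reasoning
    W : Subset n
    W = V₁ ─ fibres (labelsOf V₂)
    k≤r+w : k ≤ suc r + ∣ W ∣
    k≤r+w = k-min _ (extend-coloring colr V₂≢∅)
    r≤s : suc r ≤ length (labelsOf V₂)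
    r≤s = r-min _ (colorable-labelsOf V₂≢∅)
    ra+w≤V : suc r * ∣ V₁ ∩ fibre (part u) ∣ + ∣ W ∣ ≤ ∣ V₁ ∣
    ra+w≤V = ≤-trans (+-monoˡ-≤ ∣ W ∣ (≤-trans (*-monoˡ-≤ _ r≤s) s*a≤Σa))
                     (sum∣∩fibre∣+∣─fibres∣≤∣∣ V₁ (labelsOf-unique V₂))

lemma3p2 : ∀ {n} (G : Graph n) → IsCompleteMultipartite G →
    (V₁ V₂ : Subset n) → (∀ v → v ∈ V₁ → v ∈ V₂ → ⊥) → Nonempty V₂ →
    (r k : ℕ) → ChromaticNumber G V₂ r → ChromaticNumber G (V₁ ∪ V₂) k →
    ∃ λ u → u ∈ V₂ ×
      ((r ∸ 1) * ∣ V₁ ∣ + (k ∸ r) ≤ r * ∣ N G u ∩ V₁ ∣ ×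
       (r ∸ 1) * ∣ V₁ ∣ ≤ (r ∸ 1) * ∣ V₁ ∣ + (k ∸ r))
lemma3p2 G _ V₁ V₂ _ (v₀ , _) zero k ((c , _) , _) _ = contradiction (c v₀) ¬Fin0
lemma3p2 G (part , adj⇔) V₁ V₂ _ V₂≢∅ (suc r) k χr χk
  with CompleteMultipartite.∃-vertex-adjacent-to-most-of G part adj⇔ V₂≢∅ χr χk
... | u , u∈V₂ , bound = u , u∈V₂ , bound , m≤m+n (r * ∣ V₁ ∣) (k ∸ suc r)
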